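{- Let $\mathcal{H}$ be a family of $h$ halfspaces in $\mathbb{R}^d$ and let $k$ be a positive integer. Suppose that for some positive integer $t$ there exists an integer $m$ with the following property: the $t$-tuples of every finite point set $S\subset\mathbb{R}^d$ can be $k$-colored such that every $\mathcal{H}$-region that contains at least $m$ points of $S$ contains a $t$-tuple of each of the $k$ colors. Then for every integer $t'>t$, the same property holds with $t$ replaced by $t'$ and $m$ replaced by $m'=m+t'-t$.
   Context: A $t$-tuple of $S$ is an unordered $t$-element subset of $S$; a region contains a $t$-tuple if it contains all of its points. Given a finite family of halfspaces $\mathcal{H}=\{H_1,\dots,H_h\}$ in $\mathbb{R}^d$, a region $R$ is an $\mathcal{H}$-region if it is the intersection of finitely many halfspaces, each of which is a translate of one of the halfspaces in $\mathcal{H}$. -}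

module Defs where

open import Level using (0ℓ)
open import Data.Nat using (ℕ; zero; suc; _≤_)
open import Data.Fin using (Fin)
import Data.Fin as F
open import Data.Fin.Subset using (Subset; _∈_; ∣_∣)
open import Data.Bool using (Bool; true; false)
open import Data.List using (List)
open import Data.List.Relation.Unary.All using (All)
open import Data.Product using (Σ; _×_; _,_; ∃)
open import Relation.Nullary using (¬_)
open import Relation.Binary.PropositionalEquality using (_≡_; _≢_)
open import Algebra.Structures using (IsCommutativeRing)
open import Relation.Binary.Structures using (IsTotalOrder)

-- The real numbers, axiomatised as a Dedekind-complete ordered field.
-- (Any two such structures are isomorphic, so quantifying over all of
-- them is the same as speaking about ℝ.)

record RealField : Set₁ where
  infixl 6 _+_
  infixl 7 _*_
  infix 4 _≤ᴿ_
  field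
    Carrier : Set
    _+_ _*_ : Carrier → Carrier → Carrier
    -_      : Carrier → Carrier
    0# 1#   : Carrier
    _≤ᴿ_    : Carrier → Carrier → Set
    isCommutativeRing : IsCommutativeRing _≡_ _+_ _*_ -_ 0# 1#
    0≢1     : 0# ≢ 1#
    inverse : ∀ x → x ≢ 0# → Σ Carrier (λ y → x * y ≡ 1#)
    isTotalOrder : IsTotalOrder _≡_ _≤ᴿ_
    +-mono  : ∀ x y z → x ≤ᴿ y → x + z ≤ᴿ y + z
    *-pos   : ∀ x y → 0# ≤ᴿ x → 0# ≤ᴿ y → 0# ≤ᴿ x * y
    complete : (P : Carrier → Set) → Σ Carrier P →
               Σ Carrier (λ b → ∀ x → P x → x ≤ᴿ b) →
               Σ Carrier (λ s → (∀ x → P x → x ≤ᴿ s) ×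
                                (∀ b → (∀ x → P x → x ≤ᴿ b) → s ≤ᴿ b))

module _ (R : RealField) where
  open RealField R

  _<ᴿ_ : Carrier → Carrier → Set
  x <ᴿ y = x ≤ᴿ y × x ≢ y

  Point : ℕ → Set
  Point d = Fin d → Carrier

  sumF : ∀ {n} → (Fin n → Carrier) → Carrier
  sumF {zero}  f = 0#
  sumF {suc n} f = f F.zero + sumF (λ i → f (F.suc i))

  dot : ∀ {d} → Point d → Point d → Carrier
  dot a x = sumF (λ i → a i * x i)

  sub : ∀ {d} → Point d → Point d → Point d
  sub x v i = x i + (- v i)

  -- A halfspace { x | a·x ≤ c } (closed) or { x | a·x < c } (open),
  -- with nonzero normal vector a.
  record Halfspace (d : ℕ) : Set where
    field
      normal  : Point d
      offset  : Carrier
      strict  : Bool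
      nonzero : ¬ (∀ i → normal i ≡ 0#)

  _∈H_ : ∀ {d} → Point d → Halfspace d → Set
  x ∈H H with Halfspace.strict H
  ... | true  = dot (Halfspace.normal H) x <ᴿ Halfspace.offset H
  ... | false = dot (Halfspace.normal H) x ≤ᴿ Halfspace.offset H

  _∈Translate_by_ : ∀ {d} → Point d → Halfspace d → Point d → Set
  x ∈Translate H by v = sub x v ∈H H

  -- An 𝓗-region: intersection of finitely many translates of members of 𝓗,
  -- described by a list of (index into 𝓗, translation vector).
  Region : ∀ {d h} → (Fin h → Halfspace d) → Set
  Region {d} {h} 𝓗 = List (Fin h × Point d)

  _∈R_ : ∀ {d h} {𝓗 : Fin h → Halfspace d} → Point d → Region 𝓗 → Set
  _∈R_ {𝓗 = 𝓗} x ρ = All (λ { (j , v) → x ∈Translate (𝓗 j) by v }) ρ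

  Distinct : ∀ {d n} → (Fin n → Point d) → Set
  Distinct {n = n} S = ∀ (i j : Fin n) → (∀ c → S i c ≡ S j c) → i ≡ j

  ColoringProperty : ∀ {d h} → (Fin h → Halfspace d) → (k t m : ℕ) → Set
  ColoringProperty {d} 𝓗 k t m =
    ∀ (n : ℕ) (S : Fin n → Point d) → Distinct S →
    Σ (Subset n → Fin k) λ col →
      ∀ (ρ : Region 𝓗) →
      (Σ (Subset n) λ T → m ≤ ∣ T ∣ × (∀ i → i ∈ T → _∈R_ {𝓗 = 𝓗} (S i) ρ)) →
      ∀ (c : Fin k) →
      Σ (Subset n) λ s → ∣ s ∣ ≡ t × col s ≡ c ×
                         (∀ i → i ∈ s → _∈R_ {𝓗 = 𝓗} (S i) ρ)

-- Colour a (e + t)-tuple Q by the colour that the given colouring of the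
-- points lying after the first e points of Q assigns to the last t points
-- of Q.  If a region contains e + m points of a set, keep its first e
-- points, and take the other m (all lying after them) to find a t-tuple of
-- any prescribed colour among the later points; prepending the e kept
-- points gives an (e + t)-tuple of that colour inside the region.  Only the
-- order of the points matters, so the argument works for any kind of points
-- and ranges.
module Submission where

open import Defs
open import Data.Nat using (ℕ; _+_; _∸_; _≤_; _<_; zero; suc; s≤s)
open import Data.Nat.Properties using (m∸n+n≡m; <⇒≤; +-comm)
open import Data.Fin using (Fin)
import Data.Fin as F
open import Data.Fin.Properties using (suc-injective)
open import Data.Fin.Subset using (Subset; _∈_; ∣_∣)
open import Data.Vec using (_∷_; []; here; there)
open import Data.Vec.Functional using (tail)
open import Data.Bool using (true; false)
open import Data.Product using (Σ; _×_; _,_; proj₁; proj₂)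
open import Relation.Binary.PropositionalEquality using (_≡_; cong; subst₂)

module TupleColouring {P Range : Set} (_∈ʳ_ : P → Range → Set)
                      (Admissible : ∀ {n} → (Fin n → P) → Set)
                      (admissible-tail : ∀ {n} {S : Fin (suc n) → P} →
                                         Admissible S → Admissible (tail S)) where

  InRange : Range → ∀ {n} → (Fin n → P) → Subset n → Set
  InRange ρ S T = ∀ i → i ∈ T → S i ∈ʳ ρ

  Property : (k t m : ℕ) → Set
  Property k t m =
    ∀ (n : ℕ) (S : Fin n → P) → Admissible S →
    Σ (Subset n → Fin k) λ col →
      ∀ (ρ : Range) → (Σ (Subset n) λ T → m ≤ ∣ T ∣ × InRange ρ S T) →
      ∀ (c : Fin k) → Σ (Subset n) λ s → ∣ s ∣ ≡ t × col s ≡ c × InRange ρ S s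

  inRange-tail : ∀ {ρ n} {S : Fin (suc n) → P} {b T} →
                 InRange ρ S (b ∷ T) → InRange ρ (tail S) T
  inRange-tail inT i i∈T = inT (F.suc i) (there i∈T)

  inRange-skip : ∀ {ρ n} {S : Fin (suc n) → P} {T} →
                 InRange ρ (tail S) T → InRange ρ S (false ∷ T)
  inRange-skip inT (F.suc i) (there i∈T) = inT i i∈T

  inRange-keep : ∀ {ρ n} {S : Fin (suc n) → P} {T} →
                 S F.zero ∈ʳ ρ → InRange ρ (tail S) T → InRange ρ S (true ∷ T)
  inRange-keep S₀∈ρ inT F.zero     here         = S₀∈ρ
  inRange-keep S₀∈ρ inT (F.suc i) (there i∈T) = inT i i∈T

  module Lift {k t m : ℕ} (property : Property k t m) (c₀ : Fin k) where

    colour : ∀ (e : ℕ) {n} (S : Fin n → P) → Admissible S → Subset n → Fin k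
    colour zero    S a Q           = proj₁ (property _ S a) Q
    colour (suc e) {zero}  S a []          = c₀  -- only reached on subsets of the wrong size
    colour (suc e) {suc n} S a (true  ∷ Q) = colour e       (tail S) (admissible-tail a) Q
    colour (suc e) {suc n} S a (false ∷ Q) = colour (suc e) (tail S) (admissible-tail a) Q

    colour-complete : ∀ (e : ℕ) {n} (S : Fin n → P) (a : Admissible S) (ρ : Range)
                      (T : Subset n) → e + m ≤ ∣ T ∣ → InRange ρ S T → ∀ (c : Fin k) →
                      Σ (Subset n) λ Q → ∣ Q ∣ ≡ e + t × colour e S a Q ≡ c × InRange ρ S Q
    colour-complete zero S a ρ T m≤∣T∣ inT c = proj₂ (property _ S a) ρ (T , m≤∣T∣ , inT) c
    colour-complete (suc e) {zero} S a ρ [] () inT c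
    colour-complete (suc e) {suc n} S a ρ (true ∷ T) (s≤s e+m≤∣T∣) inT c
      with colour-complete e (tail S) (admissible-tail a) ρ T e+m≤∣T∣ (inRange-tail inT) c
    ... | Q , ∣Q∣≡e+t , colour≡c , inQ =
      true ∷ Q , cong suc ∣Q∣≡e+t , colour≡c , inRange-keep (inT F.zero here) inQ
    colour-complete (suc e) {suc n} S a ρ (false ∷ T) e+m≤∣T∣ inT c
      with colour-complete (suc e) (tail S) (admissible-tail a) ρ T e+m≤∣T∣ (inRange-tail inT) c
    ... | Q , ∣Q∣≡e+t , colour≡c , inQ = false ∷ Q , ∣Q∣≡e+t , colour≡c , inRange-skip inQ

  property-+ : ∀ {k t m} → Property k t m → Fin k → ∀ e → Property k (e + t) (e + m)
  property-+ property c₀ e n S a =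
    colour e S a , λ { ρ (T , e+m≤∣T∣ , inT) → colour-complete e S a ρ T e+m≤∣T∣ inT }
    where open Lift property c₀

distinct-tail : ∀ (R : RealField) {d n} {S : Fin (suc n) → Point R d} →
                Distinct R S → Distinct R (tail S)
distinct-tail R distinct i j Si≡Sj = suc-injective (distinct (F.suc i) (F.suc j) Si≡Sj)

theorem7 : (R : RealField) (d h : ℕ) (𝓗 : Fin h → Halfspace R d) (k : ℕ) → 1 ≤ k →
    (t : ℕ) → 1 ≤ t → (m : ℕ) → ColoringProperty R 𝓗 k t m →
    ∀ (t′ : ℕ) → t < t′ → ColoringProperty R 𝓗 k t′ (m + (t′ ∸ t))
theorem7 R d h 𝓗 (suc k) _ t _ m property t′ t<t′ =
  subst₂ (ColoringProperty R 𝓗 (suc k)) (m∸n+n≡m (<⇒≤ t<t′)) (+-comm (t′ ∸ t) m)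
         (property-+ property F.zero (t′ ∸ t))
  where open TupleColouring (λ x ρ → _∈R_ R {𝓗 = 𝓗} x ρ) (Distinct R) (distinct-tail R)
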